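{- Let $n\geqslant 5$ and $2\leqslant k<n-2$. Then $\langle r_n, r_{n-2}, r_k\rangle=\mathrm{Sym}_n$ if and only if $n$ and $k$ have different parities.
   Context: $\mathrm{Sym}_n$ is the symmetric group on $\{1,\dots,n\}$. For $1< i\leqslant n$, the prefix reversal $r_i\in\mathrm{Sym}_n$ is the permutation with $r_i(j)=i+1-j$ for $1\leqslant j\leqslant i$ and $r_i(j)=j$ for $i<j\leqslant n$. -}

module Defs where

open import Data.Nat using (ℕ; zero; suc; _∸_; _<_; _≤_; _<?_; s≤s; z≤n)
open import Data.Nat.Properties using (m∸n≤m; <-≤-trans; m∸[m∸n]≡n; ≤-pred)
open import Data.Fin using (Fin; toℕ; fromℕ<)
open import Data.Fin.Properties using (toℕ-fromℕ<; fromℕ<-toℕ; toℕ-injective)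
open import Data.Fin.Permutation using (Permutation′; _⟨$⟩ʳ_; permutation; id; _∘ₚ_; flip)
open import Data.List using (List)
open import Data.List.Membership.Propositional using (_∈_)
open import Data.Product using (Σ-syntax; _×_)
open import Relation.Binary.PropositionalEquality using (_≡_; refl; sym; trans; cong)
open import Relation.Nullary using (yes; no; contradiction)

private
  bound : ∀ n i m → i ≤ n → m < i → i ∸ 1 ∸ m < n
  bound n (suc i') m i≤n m<i = <-≤-trans (s≤s (m∸n≤m i' m)) i≤n

-- Underlying function of the prefix reversal r_i (points are 0-indexed:
-- Fin n = {0,…,n-1} stands for {1,…,n}).  This is the 0-indexed form of r_i(j) = i+1-j.
revFun : (n i : ℕ) → i ≤ n → Fin n → Fin n
revFun n i i≤n j with toℕ j <? i
... | yes j<i = fromℕ< (bound n i (toℕ j) i≤n j<i)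
... | no _ = j

revFun-invol : ∀ n i (i≤n : i ≤ n) j → revFun n i i≤n (revFun n i i≤n j) ≡ j
revFun-invol n i i≤n j with toℕ j <? i
... | no j≮i with toℕ j <? i
...   | yes j<i = contradiction j<i j≮i
...   | no _ = refl
revFun-invol n (suc i') i≤n j | yes j<i
  with toℕ (fromℕ< (bound n (suc i') (toℕ j) i≤n j<i)) <? suc i'
... | no k≮i = contradiction
        (subst′ (toℕ-fromℕ< (bound n (suc i') (toℕ j) i≤n j<i)))
        k≮i
  where
  subst′ : ∀ {x} → x ≡ i' ∸ toℕ j → x < suc i'
  subst′ refl = s≤s (m∸n≤m i' (toℕ j))
... | yes k<i = toℕ-injective (trans (toℕ-fromℕ< _)
        (trans (cong (i' ∸_) (toℕ-fromℕ< (bound n (suc i') (toℕ j) i≤n j<i)))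
               (m∸[m∸n]≡n (≤-pred j<i))))

rev : (n i : ℕ) → i ≤ n → Permutation′ n
rev n i i≤n = permutation (revFun n i i≤n) (revFun n i i≤n)
  (λ j → revFun-invol n i i≤n j) (λ j → revFun-invol n i i≤n j)

_≈ₚ_ : {n : ℕ} → Permutation′ n → Permutation′ n → Set
_≈ₚ_ {n} σ τ = (j : Fin n) → σ ⟨$⟩ʳ j ≡ τ ⟨$⟩ʳ j

data InGenerated {n : ℕ} (gens : List (Permutation′ n)) : Permutation′ n → Set where
  gen-id  : InGenerated gens id
  gen-mul : ∀ {g σ} → g ∈ gens → InGenerated gens σ → InGenerated gens (g ∘ₚ σ)
  gen-inv : ∀ {g σ} → g ∈ gens → InGenerated gens σ → InGenerated gens (flip g ∘ₚ σ)

GeneratesSym : {n : ℕ} → List (Permutation′ n) → Set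
GeneratesSym {n} gens =
  (π : Permutation′ n) → Σ[ σ ∈ Permutation′ n ] (InGenerated gens σ × σ ≈ₚ π)

open import Data.Nat.Properties using (≤-refl; <⇒≤; ≤-trans)

r-top : (n : ℕ) → Permutation′ n
r-top n = rev n n ≤-refl

r-top2 : (n : ℕ) → Permutation′ n
r-top2 n = rev n (n ∸ 2) (m∸n≤m n 2)

r-low : (n k : ℕ) → k < n ∸ 2 → Permutation′ n
r-low n k k<n-2 = rev n k (≤-trans (<⇒≤ k<n-2) (m∸n≤m n 2))

{-# OPTIONS --safe #-}
-- Positions are 0, …, n − 1. Let s be r_(n−2) followed by r_n: it moves j to j + 2 for j < n − 2,
-- n − 2 to 1 and n − 1 to 0. When n − q is odd, s followed by r_(q+2) acts as r_q on the first q
-- positions and as a cycle of odd length n − q on the others, so its (n − q)-th power is r_q. Thus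
-- from r_k one descends to r_2 = (0 1) if n is odd, or to r_3 = (0 2) if n is even. Conjugating
-- by s and r_n then gives (0 1) and (1 2), and shifting by s gives every adjacent transposition.
-- Conversely, if n and k are both even, every generator maps the pairs {2t, 2t + 1} onto pairs, and
-- if both are odd, every generator preserves the parity of positions; (1 2), resp. (0 1), does not.

module Submission where

open import Defs
open import Data.Fin using (Fin; toℕ; fromℕ<)
open import Data.Fin.Patterns using (0F; 1F; 2F)
open import Data.Fin.Permutation
  using (Permutation′; _⟨$⟩ʳ_; _⟨$⟩ˡ_; id; flip; _∘ₚ_; transpose; inverseˡ; inverseʳ)
open import Data.Fin.Permutation.Transposition.List
  using (TranspositionList; eval; decompose; eval-decompose)
open import Data.Fin.Properties using (_≟_; toℕ-fromℕ<; toℕ-injective; toℕ<n)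
open import Data.List using (List; _∷_; [])
open import Data.List.Membership.Propositional using (_∈_)
open import Data.List.Relation.Unary.Any using (here; there)
open import Data.Nat
  using (ℕ; zero; suc; _+_; _*_; _∸_; _%_; ⌊_/2⌋; _≤_; _<_; _≮_; s≤s; z≤n; _<?_; NonZero)
open import Data.Nat.DivMod
  using (%-distribˡ-+; m%n%n≡m%n; m<n⇒m%n≡m; m%n<n; n%n≡0; [m+n]%n≡m%n; [m+kn]%n≡m%n)
open import Data.Nat.Properties
  using ( ≤-refl; ≤-reflexive; ≤-trans; ≤-antisym; ≤-pred; <-trans; <-irrefl; <-≤-trans; <-cmp
        ; n≤1+n; n<1+n; ≤⇒≯; ≮⇒≥; m≤m+n; m≤n+m; m+n≤o⇒n≤o; +-monoʳ-<; +-cancelˡ-<; ∸-monoʳ-≤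
        ; +-identityʳ; +-assoc; +-suc; +-comm; *-comm
        ; m∸n≤m; +-∸-assoc; ∸-+-assoc; m∸[m∸n]≡n; m+n∸n≡m; n∸n≡0; m+[n∸m]≡n; ⌊n/2⌋-mono )
  renaming (_≟_ to _≟ℕ_)
open import Data.Product using (Σ-syntax; _×_; _,_; proj₁; proj₂)
open import Function.Bundles using (_⇔_; mk⇔)
open import Relation.Binary.Definitions using (tri<; tri≈; tri>)
open import Relation.Binary.PropositionalEquality
  using (_≡_; _≢_; refl; sym; trans; cong; subst; subst₂; module ≡-Reasoning)
open import Relation.Nullary using (¬_; Dec; yes; no; contradiction)
open import Relation.Nullary.Decidable using (dec-true; dec-false)

infix 4 _∈⟨_⟩
infixl 25 _^ₚ_

record _∈⟨_⟩ {n} (π : Permutation′ n) (gens : List (Permutation′ n)) : Set where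
  constructor generatedBy
  field
    {word} : Permutation′ n
    inGens : InGenerated gens word
    word≈π : word ≈ₚ π

_^ₚ_ : ∀ {n} → Permutation′ n → ℕ → Permutation′ n
σ ^ₚ zero  = id
σ ^ₚ suc m = σ ∘ₚ σ ^ₚ m

flip-resp-≈ : ∀ {n} {σ π : Permutation′ n} → σ ≈ₚ π → flip σ ≈ₚ flip π
flip-resp-≈ {σ = σ} {π} σ≈π y = begin
  σ ⟨$⟩ˡ y                      ≡⟨ cong (σ ⟨$⟩ˡ_) (inverseʳ π) ⟨
  σ ⟨$⟩ˡ (π ⟨$⟩ʳ (π ⟨$⟩ˡ y))    ≡⟨ cong (σ ⟨$⟩ˡ_) (σ≈π _) ⟨
  σ ⟨$⟩ˡ (σ ⟨$⟩ʳ (π ⟨$⟩ˡ y))    ≡⟨ inverseˡ σ ⟩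
  π ⟨$⟩ˡ y                      ∎
  where open ≡-Reasoning

module _ {n : ℕ} {gens : List (Permutation′ n)} where

  ∈⟨⟩-resp-≈ : ∀ {π τ} → π ≈ₚ τ → π ∈⟨ gens ⟩ → τ ∈⟨ gens ⟩
  ∈⟨⟩-resp-≈ π≈τ (generatedBy gσ σ≈π) = generatedBy gσ λ j → trans (σ≈π j) (π≈τ j)

  id∈⟨⟩ : id ∈⟨ gens ⟩
  id∈⟨⟩ = generatedBy gen-id λ _ → refl

  generator∈⟨⟩ : ∀ {g} → g ∈ gens → g ∈⟨ gens ⟩
  generator∈⟨⟩ g∈ = generatedBy (gen-mul g∈ gen-id) λ _ → refl

  private
    ∘ₚ-closed : ∀ {σ τ} → InGenerated gens σ → τ ∈⟨ gens ⟩ → σ ∘ₚ τ ∈⟨ gens ⟩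
    ∘ₚ-closed gen-id τ∈ = ∈⟨⟩-resp-≈ (λ _ → refl) τ∈
    ∘ₚ-closed (gen-mul {g} g∈ gσ) τ∈ =
      let generatedBy gρ ρ≈ = ∘ₚ-closed gσ τ∈ in generatedBy (gen-mul g∈ gρ) λ j → ρ≈ (g ⟨$⟩ʳ j)
    ∘ₚ-closed (gen-inv {g} g∈ gσ) τ∈ =
      let generatedBy gρ ρ≈ = ∘ₚ-closed gσ τ∈ in generatedBy (gen-inv g∈ gρ) λ j → ρ≈ (g ⟨$⟩ˡ j)

  ∈⟨⟩-∘ₚ : ∀ {π τ} → π ∈⟨ gens ⟩ → τ ∈⟨ gens ⟩ → π ∘ₚ τ ∈⟨ gens ⟩
  ∈⟨⟩-∘ₚ {τ = τ} (generatedBy gσ σ≈π) τ∈ =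
    ∈⟨⟩-resp-≈ (λ j → cong (τ ⟨$⟩ʳ_) (σ≈π j)) (∘ₚ-closed gσ τ∈)

  private
    flip-generator∈⟨⟩ : ∀ {g} → g ∈ gens → flip g ∈⟨ gens ⟩
    flip-generator∈⟨⟩ g∈ = generatedBy (gen-inv g∈ gen-id) λ _ → refl

    flip-closed : ∀ {σ} → InGenerated gens σ → flip σ ∈⟨ gens ⟩
    flip-closed gen-id = id∈⟨⟩
    flip-closed (gen-mul g∈ gσ) =
      ∈⟨⟩-resp-≈ (λ _ → refl) (∈⟨⟩-∘ₚ (flip-closed gσ) (flip-generator∈⟨⟩ g∈))
    flip-closed (gen-inv g∈ gσ) =
      ∈⟨⟩-resp-≈ (λ _ → refl) (∈⟨⟩-∘ₚ (flip-closed gσ) (generator∈⟨⟩ g∈))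

  ∈⟨⟩-flip : ∀ {π} → π ∈⟨ gens ⟩ → flip π ∈⟨ gens ⟩
  ∈⟨⟩-flip {π} (generatedBy {σ} gσ σ≈π) =
    ∈⟨⟩-resp-≈ (flip-resp-≈ {σ = σ} {π} σ≈π) (flip-closed gσ)

  ∈⟨⟩-^ₚ : ∀ {σ} m → σ ∈⟨ gens ⟩ → σ ^ₚ m ∈⟨ gens ⟩
  ∈⟨⟩-^ₚ zero    σ∈ = id∈⟨⟩
  ∈⟨⟩-^ₚ (suc m) σ∈ = ∈⟨⟩-∘ₚ σ∈ (∈⟨⟩-^ₚ m σ∈)

module _ {n : ℕ} (i j : Fin n) where

  transpose-i : transpose i j ⟨$⟩ʳ i ≡ j
  transpose-i rewrite dec-true (i ≟ i) refl = refl

  transpose-j : transpose i j ⟨$⟩ʳ j ≡ i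
  transpose-j with j ≟ i
  ... | yes j≡i = j≡i
  ... | no _ rewrite dec-true (j ≟ j) refl = refl

  transpose-fixes : ∀ {y} → y ≢ i → y ≢ j → transpose i j ⟨$⟩ʳ y ≡ y
  transpose-fixes y≢i y≢j rewrite dec-false (_ ≟ i) y≢i | dec-false (_ ≟ j) y≢j = refl

  ≈-transpose : ∀ σ → σ ⟨$⟩ʳ i ≡ j → σ ⟨$⟩ʳ j ≡ i →
                (∀ {y} → y ≢ i → y ≢ j → σ ⟨$⟩ʳ y ≡ y) → σ ≈ₚ transpose i j
  ≈-transpose σ σi σj σy y = by-cases (y ≟ i) (y ≟ j)
    where
    by-cases : Dec (y ≡ i) → Dec (y ≡ j) → σ ⟨$⟩ʳ y ≡ transpose i j ⟨$⟩ʳ y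
    by-cases (yes refl) _          = trans σi (sym transpose-i)
    by-cases (no _)     (yes refl) = trans σj (sym transpose-j)
    by-cases (no y≢i)   (no y≢j)   = trans (σy y≢i y≢j) (sym (transpose-fixes y≢i y≢j))

module _ {n : ℕ} {i j : Fin n} where

  id≈transpose-self : i ≡ j → id ≈ₚ transpose i j
  id≈transpose-self refl = ≈-transpose i i id refl refl (λ _ _ → refl)

  transpose-comm : transpose j i ≈ₚ transpose i j
  transpose-comm = ≈-transpose i j (transpose j i) (transpose-j j i) (transpose-i j i)
    (λ y≢i y≢j → transpose-fixes j i y≢j y≢i)

  transpose-conj : ∀ (g : Permutation′ n) →
                   (flip g ∘ₚ transpose i j ∘ₚ g) ≈ₚ transpose (g ⟨$⟩ʳ i) (g ⟨$⟩ʳ j)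
  transpose-conj g = ≈-transpose (g ⟨$⟩ʳ i) (g ⟨$⟩ʳ j) (flip g ∘ₚ transpose i j ∘ₚ g)
    (trans (conj-at i) (cong (g ⟨$⟩ʳ_) (transpose-i i j)))
    (trans (conj-at j) (cong (g ⟨$⟩ʳ_) (transpose-j i j)))
    λ y≢gi y≢gj → trans (cong (g ⟨$⟩ʳ_) (transpose-fixes i j (off y≢gi) (off y≢gj))) (inverseʳ g)
    where
    conj-at : ∀ x → (flip g ∘ₚ transpose i j ∘ₚ g) ⟨$⟩ʳ (g ⟨$⟩ʳ x) ≡ g ⟨$⟩ʳ (transpose i j ⟨$⟩ʳ x)
    conj-at x = cong (λ z → g ⟨$⟩ʳ (transpose i j ⟨$⟩ʳ z)) (inverseˡ g)
    off : ∀ {x y} → y ≢ g ⟨$⟩ʳ x → g ⟨$⟩ˡ y ≢ x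
    off y≢gx refl = y≢gx (sym (inverseʳ g))

Sends : ∀ {n} → Permutation′ n → ℕ → ℕ → Set
Sends g u v = ∀ {x} → toℕ x ≡ u → toℕ (g ⟨$⟩ʳ x) ≡ v

module Swaps {n : ℕ} (gens : List (Permutation′ n)) where

  Swap : Fin n → Fin n → Set
  Swap i j = transpose i j ∈⟨ gens ⟩

  swap-conj : ∀ {g i j} → g ∈⟨ gens ⟩ → Swap i j → Swap (g ⟨$⟩ʳ i) (g ⟨$⟩ʳ j)
  swap-conj {g} g∈ sij = ∈⟨⟩-resp-≈ (transpose-conj g) (∈⟨⟩-∘ₚ (∈⟨⟩-flip g∈) (∈⟨⟩-∘ₚ sij g∈))

  swap-sym : ∀ {i j} → Swap i j → Swap j i
  swap-sym {i} {j} = ∈⟨⟩-resp-≈ (transpose-comm {i = j} {j = i})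

  swap-trans : ∀ {i j l} → Swap i j → Swap j l → Swap i l
  swap-trans {i} {j} {l} sij sjl with i ≟ l | i ≟ j
  ... | yes i≡l | _        = ∈⟨⟩-resp-≈ (id≈transpose-self i≡l) id∈⟨⟩
  ... | no _    | yes refl = sjl
  ... | no i≢l  | no i≢j   =
    subst₂ Swap (transpose-fixes j l i≢j i≢l) (transpose-i j l) (swap-conj sjl sij)

  -- Vacuous when u or v is not below n.
  SwapAt : ℕ → ℕ → Set
  SwapAt u v = ∀ {i j} → toℕ i ≡ u → toℕ j ≡ v → Swap i j

  swapAt-refl : ∀ u → SwapAt u u
  swapAt-refl _ i≡u j≡u =
    ∈⟨⟩-resp-≈ (id≈transpose-self (toℕ-injective (trans i≡u (sym j≡u)))) id∈⟨⟩

  swapAt-sym : ∀ {u v} → SwapAt u v → SwapAt v u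
  swapAt-sym suv i≡v j≡u = swap-sym (suv j≡u i≡v)

  swapAt-trans : ∀ {u v w} → v < n → SwapAt u v → SwapAt v w → SwapAt u w
  swapAt-trans v<n suv svw i≡u l≡w =
    swap-trans (suv i≡u (toℕ-fromℕ< v<n)) (svw (toℕ-fromℕ< v<n) l≡w)

  swapAt-conj : ∀ {g u v u′ v′} → g ∈⟨ gens ⟩ → u < n → v < n →
                Sends g u u′ → Sends g v v′ → SwapAt u v → SwapAt u′ v′
  swapAt-conj {g} g∈ u<n v<n gu gv suv i≡u′ j≡v′ =
    subst₂ Swap (image gu u<n i≡u′) (image gv v<n j≡v′)
      (swap-conj g∈ (suv (toℕ-fromℕ< u<n) (toℕ-fromℕ< v<n)))
    where
    image : ∀ {u u′ x} → Sends g u u′ → (u<n : u < n) → toℕ x ≡ u′ → g ⟨$⟩ʳ fromℕ< u<n ≡ x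
    image gu u<n x≡u′ = toℕ-injective (trans (gu (toℕ-fromℕ< u<n)) (sym x≡u′))

  swaps-generate : (∀ i j → Swap i j) → GeneratesSym gens
  swaps-generate swap π =
    let generatedBy gσ σ≈π = ∈⟨⟩-resp-≈ {τ = π} (eval-decompose π) (eval∈ (decompose π))
    in _ , gσ , σ≈π
    where
    eval∈ : (xs : TranspositionList n) → eval xs ∈⟨ gens ⟩
    eval∈ []             = id∈⟨⟩
    eval∈ ((i , j) ∷ xs) = ∈⟨⟩-∘ₚ (swap i j) (eval∈ xs)

  adjacent-swaps-generate : (∀ v → suc v < n → SwapAt v (suc v)) → GeneratesSym gens
  adjacent-swaps-generate adjacent = swaps-generate λ i j →
    swapAt-trans (0<n i) (swapAt-sym (from-0 (toℕ i) (toℕ<n i))) (from-0 (toℕ j) (toℕ<n j))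
      refl refl
    where
    0<n : Fin n → 0 < n
    0<n i = ≤-trans (s≤s z≤n) (toℕ<n i)
    from-0 : ∀ v → v < n → SwapAt 0 v
    from-0 zero    _     = swapAt-refl 0
    from-0 (suc v) 1+v<n = swapAt-trans v<n (from-0 v v<n) (adjacent v 1+v<n)
      where v<n = <-trans (n<1+n v) 1+v<n

%2≢0⇒%2≡1 : ∀ m → m % 2 ≢ 0 → m % 2 ≡ 1
%2≢0⇒%2≡1 0             m≢0 = contradiction refl m≢0
%2≢0⇒%2≡1 1             _   = refl
%2≢0⇒%2≡1 (suc (suc m)) m≢0 = %2≢0⇒%2≡1 m m≢0

%2≢1⇒%2≡0 : ∀ m → m % 2 ≢ 1 → m % 2 ≡ 0
%2≢1⇒%2≡0 0             _   = refl
%2≢1⇒%2≡0 1             m≢1 = contradiction refl m≢1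
%2≢1⇒%2≡0 (suc (suc m)) m≢1 = %2≢1⇒%2≡0 m m≢1

suc-%2≡1⇒%2≡0 : ∀ m → suc m % 2 ≡ 1 → m % 2 ≡ 0
suc-%2≡1⇒%2≡0 0             _     = refl
suc-%2≡1⇒%2≡0 (suc (suc m)) m-odd = suc-%2≡1⇒%2≡0 m m-odd

suc-%2≢1⇒%2≡1 : ∀ m → suc m % 2 ≢ 1 → m % 2 ≡ 1
suc-%2≢1⇒%2≡1 0             m≢1 = contradiction refl m≢1
suc-%2≢1⇒%2≡1 1             _   = refl
suc-%2≢1⇒%2≡1 (suc (suc m)) m≢1 = suc-%2≢1⇒%2≡1 m m≢1

∸-%2≡1 : ∀ {m n} → m ≤ n → n % 2 ≢ m % 2 → (n ∸ m) % 2 ≡ 1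
∸-%2≡1 {0} {n}       _                n≢m = %2≢0⇒%2≡1 n n≢m
∸-%2≡1 {1}           (s≤s {n = n} _)  n≢m = suc-%2≢1⇒%2≡1 n n≢m
∸-%2≡1 {suc (suc m)} (s≤s (s≤s m≤n)) n≢m = ∸-%2≡1 m≤n n≢m

[m∸1+n]%2 : ∀ i j → i % 2 ≡ 1 → j < i → (i ∸ suc j) % 2 ≡ j % 2
[m∸1+n]%2 (suc i)       0             i-odd _                 = suc-%2≡1⇒%2≡0 i i-odd
[m∸1+n]%2 (suc zero)    (suc _)       _     (s≤s ())
[m∸1+n]%2 (suc (suc i)) 1             i-odd _                 = i-odd
[m∸1+n]%2 (suc (suc i)) (suc (suc j)) i-odd (s≤s (s≤s j<i)) = [m∸1+n]%2 i j i-odd j<i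

⌊1+n/2⌋≡⌊n/2⌋ : ∀ i → i % 2 ≡ 0 → ⌊ suc i /2⌋ ≡ ⌊ i /2⌋
⌊1+n/2⌋≡⌊n/2⌋ 0             _      = refl
⌊1+n/2⌋≡⌊n/2⌋ (suc (suc i)) i-even = cong suc (⌊1+n/2⌋≡⌊n/2⌋ i i-even)

⌊m∸1+n/2⌋ : ∀ i j → i % 2 ≡ 0 → ⌊ i ∸ suc j /2⌋ ≡ ⌊ i /2⌋ ∸ suc ⌊ j /2⌋
⌊m∸1+n/2⌋ 0             _             _      = refl
⌊m∸1+n/2⌋ (suc (suc i)) 0             i-even = ⌊1+n/2⌋≡⌊n/2⌋ i i-even
⌊m∸1+n/2⌋ (suc (suc i)) 1             _      = refl
⌊m∸1+n/2⌋ (suc (suc i)) (suc (suc j)) i-even = ⌊m∸1+n/2⌋ i j i-even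

%-absorbˡ : ∀ a b L .{{_ : NonZero L}} → (a % L + b) % L ≡ (a + b) % L
%-absorbˡ a b L = begin
  (a % L + b) % L          ≡⟨ %-distribˡ-+ (a % L) b L ⟩
  (a % L % L + b % L) % L  ≡⟨ cong (λ z → (z + b % L) % L) (m%n%n≡m%n a L) ⟩
  (a % L + b % L) % L      ≡⟨ %-distribˡ-+ a b L ⟨
  (a + b) % L              ∎
  where open ≡-Reasoning

+-suc-suc : ∀ m n → m + (2 + n) ≡ 2 + (m + n)
+-suc-suc m n = trans (+-suc m (suc n)) (cong suc (+-suc m n))

-- Prefix reversals

module _ {n i : ℕ} (i≤n : i ≤ n) where

  rev-head : ∀ {j} → toℕ j < i → toℕ (rev n i i≤n ⟨$⟩ʳ j) ≡ i ∸ 1 ∸ toℕ j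
  rev-head {j} j<i with toℕ j <? i
  ... | yes _   = toℕ-fromℕ< _
  ... | no j≮i = contradiction j<i j≮i

  rev-tail : ∀ {j} → i ≤ toℕ j → rev n i i≤n ⟨$⟩ʳ j ≡ j
  rev-tail {j} i≤j with toℕ j <? i
  ... | yes j<i = contradiction j<i (≤⇒≯ i≤j)
  ... | no _    = refl

  rev-head-< : ∀ {j} → toℕ j < i → toℕ (rev n i i≤n ⟨$⟩ʳ j) < i
  rev-head-< {j} j<i@(s≤s _) = subst (_< i) (sym (rev-head j<i)) (s≤s (m∸n≤m _ (toℕ j)))

module _ {n : ℕ} {i j : Fin n} (i≡0 : toℕ i ≡ 0) where

  private
    swaps-with : ∀ {k} (k≤n : k ≤ n) {x y : Fin n} {u v} → toℕ x ≡ u → toℕ y ≡ v → u < k →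
                 k ∸ 1 ∸ u ≡ v → rev n k k≤n ⟨$⟩ʳ x ≡ y
    swaps-with k≤n refl refl u<k eq = toℕ-injective (trans (rev-head k≤n u<k) eq)

  rev-2≈transpose : (2≤n : 2 ≤ n) → toℕ j ≡ 1 → rev n 2 2≤n ≈ₚ transpose i j
  rev-2≈transpose 2≤n j≡1 = ≈-transpose i j (rev n 2 2≤n)
    (swaps-with 2≤n i≡0 j≡1 (s≤s z≤n) refl)
    (swaps-with 2≤n j≡1 i≡0 (s≤s (s≤s z≤n)) refl)
    fixed
    where
    fixed : ∀ {y} → y ≢ i → y ≢ j → rev n 2 2≤n ⟨$⟩ʳ y ≡ y
    fixed {y} y≢i y≢j = by-value (toℕ y) refl
      where
      by-value : ∀ u → toℕ y ≡ u → rev n 2 2≤n ⟨$⟩ʳ y ≡ y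
      by-value 0 y≡0 = contradiction (toℕ-injective (trans y≡0 (sym i≡0))) y≢i
      by-value 1 y≡1 = contradiction (toℕ-injective (trans y≡1 (sym j≡1))) y≢j
      by-value (suc (suc _)) y≡ = rev-tail 2≤n (subst (2 ≤_) (sym y≡) (s≤s (s≤s z≤n)))

  rev-3≈transpose : (3≤n : 3 ≤ n) → toℕ j ≡ 2 → rev n 3 3≤n ≈ₚ transpose i j
  rev-3≈transpose 3≤n j≡2 = ≈-transpose i j (rev n 3 3≤n)
    (swaps-with 3≤n i≡0 j≡2 (s≤s z≤n) refl)
    (swaps-with 3≤n j≡2 i≡0 (s≤s (s≤s (s≤s z≤n))) refl)
    fixed
    where
    fixed : ∀ {y} → y ≢ i → y ≢ j → rev n 3 3≤n ⟨$⟩ʳ y ≡ y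
    fixed {y} y≢i y≢j = by-value (toℕ y) refl
      where
      by-value : ∀ u → toℕ y ≡ u → rev n 3 3≤n ⟨$⟩ʳ y ≡ y
      by-value 0 y≡0 = contradiction (toℕ-injective (trans y≡0 (sym i≡0))) y≢i
      by-value 1 y≡1 = swaps-with 3≤n y≡1 y≡1 (s≤s (s≤s z≤n)) refl
      by-value 2 y≡2 = contradiction (toℕ-injective (trans y≡2 (sym j≡2))) y≢j
      by-value (suc (suc (suc _))) y≡ = rev-tail 3≤n (subst (3 ≤_) (sym y≡) (s≤s (s≤s (s≤s z≤n))))

-- σ ∘ₚ τ applies σ first.
shift₂ : ∀ n → Permutation′ n
shift₂ n = r-top2 n ∘ₚ r-top n

module _ {n : ℕ} where

  r-top-sends : ∀ {u} → u < n → Sends (r-top n) u (n ∸ 1 ∸ u)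
  r-top-sends _ {x} refl = rev-head ≤-refl (toℕ<n x)

  shift₂-sends-+2 : ∀ {u} → 2 + u < n → Sends (shift₂ n) u (2 + u)
  shift₂-sends-+2 {u} 2+u<n {x} refl = begin
    toℕ (r-top n ⟨$⟩ʳ (r-top2 n ⟨$⟩ʳ x)) ≡⟨ r-top-sends (toℕ<n _) refl ⟩
    n ∸ 1 ∸ toℕ (r-top2 n ⟨$⟩ʳ x)        ≡⟨ cong (n ∸ 1 ∸_) (rev-head (m∸n≤m n 2) (below 2+u<n)) ⟩
    n ∸ 1 ∸ (n ∸ 2 ∸ 1 ∸ u)              ≡⟨ reflect-twice 2+u<n ⟩
    2 + u                                ∎
    where
    open ≡-Reasoning
    below : ∀ {n u} → 2 + u < n → u < n ∸ 2
    below (s≤s (s≤s u<m)) = u<m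
    reflect-twice : ∀ {n u} → 2 + u < n → n ∸ 1 ∸ (n ∸ 2 ∸ 1 ∸ u) ≡ 2 + u
    reflect-twice {suc (suc (suc m))} {u} (s≤s (s≤s (s≤s u≤m))) =
      trans (+-∸-assoc 2 (m∸n≤m m u)) (cong (2 +_) (m∸[m∸n]≡n u≤m))

  shift₂-sends-n∸2 : 2 ≤ n → Sends (shift₂ n) (n ∸ 2) 1
  shift₂-sends-n∸2 (s≤s (s≤s {n = m} _)) {x} x≡m =
    trans (r-top-sends (toℕ<n x′) refl) (trans (cong (suc m ∸_) x′≡m) (m+n∸n≡m 1 m))
    where
    x′ = r-top2 n ⟨$⟩ʳ x
    x′≡m : toℕ x′ ≡ m
    x′≡m = trans (cong toℕ (rev-tail (m∸n≤m n 2) (≤-reflexive (sym x≡m)))) x≡m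

  shift₂-sends-n∸1 : Sends (shift₂ n) (n ∸ 1) 0
  shift₂-sends-n∸1 {x} x≡n∸1 =
    trans (r-top-sends (toℕ<n x′) refl) (trans (cong (n ∸ 1 ∸_) x′≡n∸1) (n∸n≡0 (n ∸ 1)))
    where
    x′ = r-top2 n ⟨$⟩ʳ x
    n∸2≤x : n ∸ 2 ≤ toℕ x
    n∸2≤x = subst (n ∸ 2 ≤_) (sym x≡n∸1) (∸-monoʳ-≤ n (s≤s z≤n))
    x′≡n∸1 : toℕ x′ ≡ n ∸ 1
    x′≡n∸1 = trans (cong toℕ (rev-tail (m∸n≤m n 2) n∸2≤x)) x≡n∸1

-- Descent from r_(q+2) to r_q

^ₚ-odd-involutive : ∀ {n} {σ : Permutation′ n} {x} m → m % 2 ≡ 1 →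
                    σ ⟨$⟩ʳ (σ ⟨$⟩ʳ x) ≡ x → σ ^ₚ m ⟨$⟩ʳ x ≡ σ ⟨$⟩ʳ x
^ₚ-odd-involutive 1 _ _ = refl
^ₚ-odd-involutive {σ = σ} (suc (suc m)) m-odd σσx =
  trans (cong (σ ^ₚ m ⟨$⟩ʳ_) σσx) (^ₚ-odd-involutive m m-odd σσx)

^ₚ-rotates : ∀ {n q L d} .{{_ : NonZero L}} {σ : Permutation′ n} →
             (∀ {r} → r < L → Sends σ (q + r) (q + (r + d) % L)) →
             ∀ m {r} → r < L → Sends (σ ^ₚ m) (q + r) (q + (r + m * d) % L)
^ₚ-rotates {q = q} {L} _ zero {r} r<L x≡q+r =
  trans x≡q+r (cong (q +_) (sym (trans (cong (_% L) (+-identityʳ r)) (m<n⇒m%n≡m r<L))))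
^ₚ-rotates {q = q} {L} {d} σ-rotates (suc m) {r} r<L x≡q+r =
  trans (^ₚ-rotates σ-rotates m (m%n<n (r + d) L) (σ-rotates r<L x≡q+r))
        (cong (q +_) (trans (%-absorbˡ (r + d) (m * d) L) (cong (_% L) (+-assoc r d (m * d)))))

module _ {q L′ : ℕ} where

  private
    N L : ℕ
    N = 2 + q + L′
    L = 2 + L′

    module _ (p : 2 + q ≤ N) (p′ : q ≤ N) where

      w : Permutation′ N
      w = shift₂ N ∘ₚ rev N (2 + q) p

      w-head : ∀ {x} → toℕ x < q → w ⟨$⟩ʳ x ≡ rev N q p′ ⟨$⟩ʳ x
      w-head {x} x<q = toℕ-injective (begin
        toℕ (rev N (2 + q) p ⟨$⟩ʳ (shift₂ N ⟨$⟩ʳ x)) ≡⟨ rev-head p moved-in-head ⟩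
        suc q ∸ toℕ (shift₂ N ⟨$⟩ʳ x)               ≡⟨ cong (suc q ∸_) moved ⟩
        q ∸ (1 + toℕ x)                             ≡⟨ ∸-+-assoc q 1 (toℕ x) ⟨
        q ∸ 1 ∸ toℕ x                               ≡⟨ rev-head p′ x<q ⟨
        toℕ (rev N q p′ ⟨$⟩ʳ x)                     ∎)
        where
        open ≡-Reasoning
        2+x<2+q : 2 + toℕ x < 2 + q
        2+x<2+q = s≤s (s≤s x<q)
        moved : toℕ (shift₂ N ⟨$⟩ʳ x) ≡ 2 + toℕ x
        moved = shift₂-sends-+2 (≤-trans 2+x<2+q (s≤s (s≤s (m≤m+n q L′)))) refl
        moved-in-head : toℕ (shift₂ N ⟨$⟩ʳ x) < 2 + q
        moved-in-head = subst (_< 2 + q) (sym moved) 2+x<2+q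

      w-involutive-head : ∀ {x} → toℕ x < q → w ⟨$⟩ʳ (w ⟨$⟩ʳ x) ≡ x
      w-involutive-head {x} x<q =
        trans (cong (w ⟨$⟩ʳ_) (w-head x<q))
              (trans (w-head (rev-head-< p′ x<q)) (revFun-invol N q p′ x))

      w-inner : ∀ {r} → r < L′ → Sends w (q + r) (2 + (q + r))
      w-inner {r} r<L′ {x} x≡q+r =
        trans (cong toℕ (rev-tail p (subst (2 + q ≤_) (sym moved) (s≤s (s≤s (m≤m+n q r)))))) moved
        where
        2+q+r<N : 2 + (q + r) < N
        2+q+r<N = s≤s (s≤s (+-monoʳ-< q r<L′))
        moved : toℕ (shift₂ N ⟨$⟩ʳ x) ≡ 2 + (q + r)
        moved = trans (shift₂-sends-+2 (subst (λ z → 2 + z < N) (sym x≡q+r) 2+q+r<N) refl)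
                      (cong (2 +_) x≡q+r)

      w-next-to-last : Sends w (q + L′) q
      w-next-to-last {x} x≡q+L′ =
        trans (rev-head p (subst (_< 2 + q) (sym moved) (s≤s (s≤s z≤n)))) (cong (suc q ∸_) moved)
        where
        moved : toℕ (shift₂ N ⟨$⟩ʳ x) ≡ 1
        moved = shift₂-sends-n∸2 (s≤s (s≤s z≤n)) x≡q+L′

      w-last : Sends w (q + suc L′) (suc q)
      w-last {x} x≡q+1+L′ =
        trans (rev-head p (subst (_< 2 + q) (sym moved) (s≤s z≤n))) (cong (suc q ∸_) moved)
        where
        moved : toℕ (shift₂ N ⟨$⟩ʳ x) ≡ 0
        moved = shift₂-sends-n∸1 (trans x≡q+1+L′ (+-suc q L′))

      w-rotates-tail : ∀ {r} → r < L → Sends w (q + r) (q + (r + 2) % L)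
      w-rotates-tail {r} r<L x≡q+r with <-cmp r L′
      ... | tri< r<L′ _ _ = trans (w-inner r<L′ x≡q+r) (begin
        2 + (q + r)      ≡⟨ +-suc-suc q r ⟨
        q + (2 + r)      ≡⟨ cong (q +_) (+-comm 2 r) ⟩
        q + (r + 2)      ≡⟨ cong (q +_) (m<n⇒m%n≡m (subst (_< L) (+-comm 2 r) (s≤s (s≤s r<L′)))) ⟨
        q + (r + 2) % L  ∎)
        where open ≡-Reasoning
      ... | tri≈ _ refl _ = trans (w-next-to-last x≡q+r) (begin
        q                 ≡⟨ +-identityʳ q ⟨
        q + 0             ≡⟨ cong (q +_) (trans (cong (_% L) (+-comm L′ 2)) (n%n≡0 L)) ⟨
        q + (L′ + 2) % L  ∎)
        where open ≡-Reasoning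
      ... | tri> _ _ L′<r with ≤-antisym (≤-pred r<L) L′<r
      ...   | refl = trans (w-last x≡q+r) (begin
        suc q                 ≡⟨ +-comm 1 q ⟩
        q + 1                 ≡⟨ cong (q +_) ([m+n]%n≡m%n 1 L) ⟨
        q + (1 + L) % L       ≡⟨ cong (λ z → q + suc z % L) (+-comm L′ 2) ⟨
        q + (suc L′ + 2) % L  ∎)
        where open ≡-Reasoning

      w^L≈rev : L′ % 2 ≡ 1 → w ^ₚ L ≈ₚ rev N q p′
      w^L≈rev L′-odd y = by-cases (toℕ y <? q)
        where
        by-cases : Dec (toℕ y < q) → w ^ₚ L ⟨$⟩ʳ y ≡ rev N q p′ ⟨$⟩ʳ y
        by-cases (yes y<q) = trans (^ₚ-odd-involutive L L′-odd (w-involutive-head y<q)) (w-head y<q)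
        by-cases (no y≮q)  = toℕ-injective (begin
          toℕ (w ^ₚ L ⟨$⟩ʳ y)      ≡⟨ ^ₚ-rotates w-rotates-tail L r<L (sym q+r≡y) ⟩
          q + (r + L * 2) % L      ≡⟨ cong (q +_) full-turn ⟩
          q + r                    ≡⟨ q+r≡y ⟩
          toℕ y                    ≡⟨ cong toℕ (rev-tail p′ q≤y) ⟨
          toℕ (rev N q p′ ⟨$⟩ʳ y)  ∎)
          where
          open ≡-Reasoning
          q≤y = ≮⇒≥ y≮q
          r = toℕ y ∸ q
          q+r≡y : q + r ≡ toℕ y
          q+r≡y = m+[n∸m]≡n q≤y
          r<L : r < L
          r<L = +-cancelˡ-< q r L (subst₂ _<_ (sym q+r≡y) (sym (+-suc-suc q L′)) (toℕ<n y))
          full-turn : (r + L * 2) % L ≡ r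
          full-turn = trans (cong (λ z → (r + z) % L) (*-comm L 2))
                            (trans ([m+kn]%n≡m%n r 2 L) (m<n⇒m%n≡m r<L))

  rev-descent : ∀ {n} → 2 + q + L′ ≡ n → L′ % 2 ≡ 1 → (p : 2 + q ≤ n) (p′ : q ≤ n) →
                (shift₂ n ∘ₚ rev n (2 + q) p) ^ₚ (2 + L′) ≈ₚ rev n q p′
  rev-descent refl L′-odd p p′ = w^L≈rev p p′ L′-odd

-- Generation

module Generation {n : ℕ} (gens : List (Permutation′ n))
                  (r-top∈ : r-top n ∈⟨ gens ⟩) (r-top2∈ : r-top2 n ∈⟨ gens ⟩) where

  open Swaps gens

  shift₂∈ : shift₂ n ∈⟨ gens ⟩
  shift₂∈ = ∈⟨⟩-∘ₚ r-top2∈ r-top∈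

  swapAt-shift₂ : ∀ {u v} → 2 + u < n → 2 + v < n → SwapAt u v → SwapAt (2 + u) (2 + v)
  swapAt-shift₂ 2+u<n 2+v<n = swapAt-conj shift₂∈ (m+n≤o⇒n≤o 2 2+u<n) (m+n≤o⇒n≤o 2 2+v<n)
    (shift₂-sends-+2 2+u<n) (shift₂-sends-+2 2+v<n)

  swaps-01-12-generate : SwapAt 0 1 → SwapAt 1 2 → GeneratesSym gens
  swaps-01-12-generate s01 s12 = adjacent-swaps-generate adjacent
    where
    adjacent : ∀ v → suc v < n → SwapAt v (suc v)
    adjacent 0             _     = s01
    adjacent 1             _     = s12
    adjacent (suc (suc v)) 3+v<n =
      swapAt-shift₂ (<-trans (n<1+n _) 3+v<n) 3+v<n (adjacent v (m+n≤o⇒n≤o 2 3+v<n))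

  odd-generates : n % 2 ≡ 1 → (p : 2 ≤ n) → rev n 2 p ∈⟨ gens ⟩ → GeneratesSym gens
  odd-generates () (s≤s (s≤s {n = zero} _)) _
  odd-generates n-odd p@(s≤s (s≤s {n = suc m} _)) r₂∈ = swaps-01-12-generate s01 (swapAt-sym s21)
    where
    s01 : SwapAt 0 1
    s01 i≡0 j≡1 = ∈⟨⟩-resp-≈ (rev-2≈transpose i≡0 p j≡1) r₂∈
    even-adjacent : ∀ d → d % 2 ≡ 0 → suc d < n → SwapAt d (suc d)
    even-adjacent 0             _      _     = s01
    even-adjacent (suc (suc d)) d-even 3+d<n =
      swapAt-shift₂ (<-trans (n<1+n _) 3+d<n) 3+d<n (even-adjacent d d-even (m+n≤o⇒n≤o 2 3+d<n))
    m<n : m < n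
    m<n = ≤-trans (n≤1+n (suc m)) (n≤1+n _)
    1+m<n : suc m < n
    1+m<n = n≤1+n _
    s21 : SwapAt 2 1
    s21 = swapAt-conj r-top∈ m<n 1+m<n
      (λ x≡m → trans (r-top-sends m<n x≡m) (m+n∸n≡m 2 m))
      (λ x≡1+m → trans (r-top-sends 1+m<n x≡1+m) (m+n∸n≡m 1 m))
      (even-adjacent m (suc-%2≡1⇒%2≡0 m n-odd) 1+m<n)

  even-generates : n % 2 ≡ 0 → (p : 3 ≤ n) → rev n 3 p ∈⟨ gens ⟩ → GeneratesSym gens
  even-generates n-even p@(s≤s (s≤s (s≤s {n = m} _))) r₃∈ =
    swaps-01-12-generate (swapAt-trans p s02 s21) (swapAt-sym s21)
    where
    s02 : SwapAt 0 2
    s02 i≡0 j≡2 = ∈⟨⟩-resp-≈ (rev-3≈transpose i≡0 p j≡2) r₃∈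
    0-to-even : ∀ d → d % 2 ≡ 0 → d < n → SwapAt 0 d
    0-to-even 0             _      _     = swapAt-refl 0
    0-to-even (suc (suc d)) d-even 2+d<n =
      swapAt-trans p s02 (swapAt-shift₂ p 2+d<n (0-to-even d d-even (m+n≤o⇒n≤o 2 2+d<n)))
    s21 : SwapAt 2 1
    s21 = swapAt-conj shift₂∈ (s≤s z≤n) (n≤1+n _)
      (shift₂-sends-+2 p) (shift₂-sends-n∸2 (s≤s (s≤s z≤n)))
      (0-to-even (suc m) n-even (n≤1+n _))

  reversal-generates : ∀ {k} (k≤n : k ≤ n) → 2 ≤ k → n % 2 ≢ k % 2 →
                       rev n k k≤n ∈⟨ gens ⟩ → GeneratesSym gens
  reversal-generates {1} _ (s≤s ()) _ _
  reversal-generates {2} p _ n≢k r∈ = odd-generates (%2≢0⇒%2≡1 n n≢k) p r∈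
  reversal-generates {3} p _ n≢k r∈ = even-generates (%2≢1⇒%2≡0 n n≢k) p r∈
  reversal-generates {suc (suc q@(suc (suc _)))} p _ n≢k r∈ =
    reversal-generates q≤n (s≤s (s≤s z≤n)) n≢k (∈⟨⟩-resp-≈ descent (∈⟨⟩-^ₚ L (∈⟨⟩-∘ₚ shift₂∈ r∈)))
    where
    q≤n : q ≤ n
    q≤n = m+n≤o⇒n≤o 2 p
    L = 2 + (n ∸ (2 + q))
    descent : (shift₂ n ∘ₚ rev n (2 + q) p) ^ₚ L ≈ₚ rev n q q≤n
    descent = rev-descent (m+[n∸m]≡n p) (∸-%2≡1 p n≢k) p q≤n

-- Invariants

PreservesFibres : ∀ {n} {A : Set} → (Fin n → A) → Permutation′ n → Set
PreservesFibres f σ = ∀ {x y} → f x ≡ f y → f (σ ⟨$⟩ʳ x) ≡ f (σ ⟨$⟩ʳ y)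

module _ {n : ℕ} {A : Set} (f : Fin n → A) {gens : List (Permutation′ n)}
         (generators-preserve : ∀ {g} → g ∈ gens →
                                PreservesFibres f g × PreservesFibres f (flip g)) where

  InGenerated-preserves : ∀ {σ} → InGenerated gens σ → PreservesFibres f σ
  InGenerated-preserves gen-id          fx≡fy = fx≡fy
  InGenerated-preserves (gen-mul g∈ gσ) fx≡fy =
    InGenerated-preserves gσ (proj₁ (generators-preserve g∈) fx≡fy)
  InGenerated-preserves (gen-inv g∈ gσ) fx≡fy =
    InGenerated-preserves gσ (proj₂ (generators-preserve g∈) fx≡fy)

  fibres-obstruct : ∀ π → ¬ PreservesFibres f π → ¬ GeneratesSym gens
  fibres-obstruct π π-breaks G with G π
  ... | _ , gσ , σ≈π = π-breaks λ {x} {y} fx≡fy →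
    subst₂ (λ a b → f a ≡ f b) (σ≈π x) (σ≈π y) (InGenerated-preserves gσ fx≡fy)

pairIndex : ∀ {n} → Fin n → ℕ
pairIndex x = ⌊ toℕ x /2⌋

module _ {n i : ℕ} (i≤n : i ≤ n) where

  rev-preserves-pairs : i % 2 ≡ 0 → PreservesFibres pairIndex (rev n i i≤n)
  rev-preserves-pairs i-even {x} {y} x~y = by-cases (toℕ x <? i) (toℕ y <? i)
    where
    head-pair : ∀ {z} → toℕ z < i → pairIndex (rev n i i≤n ⟨$⟩ʳ z) ≡ ⌊ i /2⌋ ∸ suc (pairIndex z)
    head-pair {z} z<i = trans (cong ⌊_/2⌋ (trans (rev-head i≤n z<i) (∸-+-assoc i 1 (toℕ z))))
                              (⌊m∸1+n/2⌋ i (toℕ z) i-even)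
    tail-pair : ∀ {z} → toℕ z ≮ i → pairIndex (rev n i i≤n ⟨$⟩ʳ z) ≡ pairIndex z
    tail-pair z≮i = cong pairIndex (rev-tail i≤n (≮⇒≥ z≮i))
    separated : ∀ {a b} → toℕ a < i → toℕ b ≮ i → pairIndex a ≢ pairIndex b
    separated {a} a<i b≮i a~b = <-irrefl a~b (<-≤-trans below (⌊n/2⌋-mono (≮⇒≥ b≮i)))
      where
      below : pairIndex a < ⌊ i /2⌋
      below = subst (pairIndex a <_) (⌊1+n/2⌋≡⌊n/2⌋ i i-even) (⌊n/2⌋-mono (s≤s a<i))
    by-cases : Dec (toℕ x < i) → Dec (toℕ y < i) →
               pairIndex (rev n i i≤n ⟨$⟩ʳ x) ≡ pairIndex (rev n i i≤n ⟨$⟩ʳ y)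
    by-cases (yes x<i) (yes y<i) =
      trans (head-pair x<i) (trans (cong (λ b → ⌊ i /2⌋ ∸ suc b) x~y) (sym (head-pair y<i)))
    by-cases (no x≮i)  (no y≮i)  = trans (tail-pair x≮i) (trans x~y (sym (tail-pair y≮i)))
    by-cases (yes x<i) (no y≮i)  = contradiction x~y (separated x<i y≮i)
    by-cases (no x≮i)  (yes y<i) = contradiction (sym x~y) (separated y<i x≮i)

  rev-preserves-parity : i % 2 ≡ 1 → PreservesFibres (λ x → toℕ x % 2) (rev n i i≤n)
  rev-preserves-parity i-odd {x} {y} x~y = trans (same-parity x) (trans x~y (sym (same-parity y)))
    where
    same-parity : ∀ z → toℕ (rev n i i≤n ⟨$⟩ʳ z) % 2 ≡ toℕ z % 2
    same-parity z = by-cases (toℕ z <? i)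
      where
      by-cases : Dec (toℕ z < i) → toℕ (rev n i i≤n ⟨$⟩ʳ z) % 2 ≡ toℕ z % 2
      by-cases (yes z<i) = trans (cong (_% 2) (trans (rev-head i≤n z<i) (∸-+-assoc i 1 (toℕ z))))
                                 ([m∸1+n]%2 i (toℕ z) i-odd z<i)
      by-cases (no z≮i)  = cong (λ w → toℕ w % 2) (rev-tail i≤n (≮⇒≥ z≮i))

IsReversal : ∀ {n} → (ℕ → Set) → Permutation′ n → Set
IsReversal {n} P g = Σ[ i ∈ ℕ ] Σ[ i≤n ∈ i ≤ n ] (P i × g ≡ rev n i i≤n)

module _ {n : ℕ} {gens : List (Permutation′ n)} where

  private
    reversals-preserve : ∀ {A : Set} {f : Fin n → A} {P : ℕ → Set} →
                         (∀ {i} (i≤n : i ≤ n) → P i → PreservesFibres f (rev n i i≤n)) →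
                         (∀ {g} → g ∈ gens → IsReversal P g) →
                         ∀ {g} → g ∈ gens → PreservesFibres f g × PreservesFibres f (flip g)
    reversals-preserve preserves reversal g∈ with reversal g∈
    ... | _ , i≤n , Pi , refl = preserves i≤n Pi , preserves i≤n Pi

  same-parity-reversals-obstruct : 3 ≤ n →
                                   (∀ {g} → g ∈ gens → IsReversal (λ i → i % 2 ≡ n % 2) g) →
                                   ¬ GeneratesSym gens
  same-parity-reversals-obstruct (s≤s (s≤s (s≤s _))) reversal = by-cases (n % 2 ≟ℕ 0)
    where
    pairs-broken : ¬ PreservesFibres pairIndex (transpose 1F 2F)
    pairs-broken preserves = contradiction (preserves {0F} {1F} refl) λ ()
    parity-broken : ¬ PreservesFibres (λ x → toℕ x % 2) (transpose 0F 1F)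
    parity-broken preserves = contradiction (preserves {0F} {2F} refl) λ ()
    by-cases : Dec (n % 2 ≡ 0) → ¬ GeneratesSym gens
    by-cases (yes n-even) = fibres-obstruct pairIndex
      (reversals-preserve (λ i≤n i≡n → rev-preserves-pairs i≤n (trans i≡n n-even)) reversal)
      (transpose 1F 2F) pairs-broken
    by-cases (no n≢0) = fibres-obstruct (λ x → toℕ x % 2)
      (reversals-preserve (λ i≤n i≡n → rev-preserves-parity i≤n (trans i≡n n-odd)) reversal)
      (transpose 0F 1F) parity-broken
      where n-odd = %2≢0⇒%2≡1 n n≢0

mainTheorem6 : (n k : ℕ) → 5 ≤ n → 2 ≤ k → (k<n-2 : k < n ∸ 2) →
    GeneratesSym (r-top n ∷ r-top2 n ∷ r-low n k k<n-2 ∷ []) ⇔ (n % 2 ≢ k % 2)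
mainTheorem6 n@(suc (suc m)) k (s≤s (s≤s 3≤m)) 2≤k k<n-2 = mk⇔ parities-differ generates
  where
  gens : List (Permutation′ n)
  gens = r-top n ∷ r-top2 n ∷ r-low n k k<n-2 ∷ []

  open Generation gens (generator∈⟨⟩ (here refl)) (generator∈⟨⟩ (there (here refl)))

  generates : n % 2 ≢ k % 2 → GeneratesSym gens
  generates n≢k = reversal-generates _ 2≤k n≢k (generator∈⟨⟩ (there (there (here refl))))

  reversal-lengths : n % 2 ≡ k % 2 → ∀ {g} → g ∈ gens → IsReversal (λ i → i % 2 ≡ n % 2) g
  reversal-lengths _   (here refl)                 = n , _ , refl , refl
  reversal-lengths _   (there (here refl))         = m , _ , refl , refl
  reversal-lengths n≡k (there (there (here refl))) = k , _ , sym n≡k , refl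

  parities-differ : GeneratesSym gens → n % 2 ≢ k % 2
  parities-differ G n≡k =
    same-parity-reversals-obstruct (≤-trans 3≤m (m≤n+m m 2)) (reversal-lengths n≡k) G
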